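{- Let $\mathsf{L}$ be any of the logics $\mathsf{N}_\preccurlyeq$, $\mathsf{NN}_\preccurlyeq$, $\mathsf{NT}_\preccurlyeq$, $\mathsf{NW}_\preccurlyeq$, $\mathsf{NC}_\preccurlyeq$, $\mathsf{NU}_\preccurlyeq$, $\mathsf{NNU}_\preccurlyeq$, $\mathsf{NTU}_\preccurlyeq$, $\mathsf{NWU}_\preccurlyeq$, $\mathsf{NCU}_\preccurlyeq$, $\mathsf{NA}_\preccurlyeq$, $\mathsf{NNA}_\preccurlyeq$, $\mathsf{NTA}_\preccurlyeq$, $\mathsf{NWA}_\preccurlyeq$, $\mathsf{NCA}_\preccurlyeq$. For every formula $A$, if $A$ is valid in all $\mathsf{L}$-models, then $A$ is derivable in $\mathsf{L}$.
   Context: Language: formulas are given by $A ::= p \mid \bot \mid A\to A \mid A \preccurlyeq A$ with $p$ ranging over a countable set $Atm$ of propositional variables; $\top,\neg,\wedge,\vee$ are defined as usual from $\bot,\to$. A neighbourhood model is $\mathcal M=\langle W,N,V\rangle$ with $W\neq\emptyset$, $V:Atm\to\mathcal P(W)$, and $N:W\to\mathcal P(\mathcal P(W))$ such that $\emptyset\notin N(w)$ for all $w$. Forcing: $w\Vdash p$ iff $w\in V(p)$; $w\not\Vdash\bot$; $w\Vdash B\to C$ iff $w\Vdash B$ implies $w\Vdash C$; $w\Vdash B\preccurlyeq C$ iff for all $\alpha\in N(w)$, if some $v\in\alpha$ has $v\Vdash C$ then some $u\in\alpha$ has $u\Vdash B$. $A$ is valid in $\mathcal M$ if forced at every world, and valid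 in a class if valid in each model of the class. Model conditions (for all $w$): (N) $N(w)\neq\emptyset$; (T) there is $\alpha\in N(w)$ with $w\in\alpha$; (W) $N(w)\neq\emptyset$ and $w\in\alpha$ for all $\alpha\in N(w)$; (C) $\{w\}\in N(w)$ and $w\in\alpha$ for all $\alpha\in N(w)$; (U) if $\alpha\in N(w)$ and $v\in\alpha$ then $\bigcup N(v)=\bigcup N(w)$; (A) if $\alpha\in N(w)$ and $v\in\alpha$ then $N(v)=N(w)$. Axioms and rules: (cpr) from $A\to B$ infer $B\preccurlyeq A$; (tr) $(A\preccurlyeq B)\wedge(B\preccurlyeq C)\to(A\preccurlyeq C)$; (or) $(A\preccurlyeq B)\wedge(A\preccurlyeq C)\to(A\preccurlyeq B\vee C)$; (n) $\neg(\bot\preccurlyeq\top)$; (t) $(\bot\preccurlyeq A)\to\neg A$; (w) $A\to(A\preccurlyeq\top)$; (c) $(A\preccurlyeq\top)\to A$; (u$-$) $\neg(\bot\preccurlyeq A)\to(\bot\preccurlyeq(\bot\preccurlyeq A))$; (u) $(\bot\preccurlyeq A)\to(\bot\preccurlyeq\neg(\bot\preccurlyeq A))$; (a$-$) $(A\preccurlyeq B)\to(\bot\preccurlyeq\neg(A\preccurlyeq B))$; (a) $\neg(A\preccurlyeq B)\to(\bot\preccurlyeq(A\preccurlyeq B))$. Logics: $\mathsf{N}_\preccurlyeq$ = classical propositional logic (in this language) plus tr, or, cpr; $\mathsf{NN}_\preccurlyeq=\mathsf N_\preccurlyeq+$n; $\mathsf{NT}_\preccurlyeq=\mathsf N_\preccurlyeq+$t;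 $\mathsf{NW}_\preccurlyeq=\mathsf{NT}_\preccurlyeq+$w; $\mathsf{NC}_\preccurlyeq=\mathsf{NW}_\preccurlyeq+$c; for each such $\mathsf{L}$ (written $\mathsf{N}X_\preccurlyeq$), $\mathsf{N}XU_\preccurlyeq=\mathsf L+$u$-$,u and $\mathsf{N}XA_\preccurlyeq=\mathsf L+$a$-$,a. $A$ is derivable in $\mathsf L$ if there is a finite sequence ending in $A$ each element of which is an axiom of $\mathsf L$ or follows from earlier ones by modus ponens or cpr. An $\mathsf L$-model is a neighbourhood model satisfying the conditions named by the letters after the initial N in the name of $\mathsf L$ (e.g. $\mathsf{NTU}_\preccurlyeq$-models satisfy (T) and (U); $\mathsf N_\preccurlyeq$-models are all neighbourhood models). -}

module Defs where

open import Data.Nat using (ℕ)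
open import Data.Bool using (Bool; true; false)
open import Data.Product using (Σ; _×_; _,_)
open import Data.Sum using (_⊎_)
open import Data.Empty using (⊥)
open import Relation.Nullary using (¬_; Dec)
open import Relation.Binary.PropositionalEquality using (_≡_)

infixr 5 _⇒_
infix 6 _≼_

data Fm : Set where
  var : ℕ → Fm
  fls : Fm
  _⇒_ : Fm → Fm → Fm
  _≼_ : Fm → Fm → Fm

tru : Fm
tru = fls ⇒ fls

neg : Fm → Fm
neg A = A ⇒ fls

_∨′_ : Fm → Fm → Fm
A ∨′ B = neg A ⇒ B

_∧′_ : Fm → Fm → Fm
A ∧′ B = neg (A ⇒ neg B)

data Base : Set where
  bN bNN bNT bNW bNC : Base

data Ext : Set where
  eNone eU eA : Ext

record Logic : Set where
  constructor logic
  field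
    base : Base
    ext  : Ext

-- Axioms of a logic (classical propositional part given by a standard
-- complete Hilbert system for →, ⊥).

data Axiom (L : Logic) : Fm → Set where
  ax-K  : ∀ A B → Axiom L (A ⇒ B ⇒ A)
  ax-S  : ∀ A B C → Axiom L ((A ⇒ B ⇒ C) ⇒ (A ⇒ B) ⇒ A ⇒ C)
  ax-DN : ∀ A → Axiom L (neg (neg A) ⇒ A)
  ax-tr : ∀ A B C → Axiom L (((A ≼ B) ∧′ (B ≼ C)) ⇒ (A ≼ C))
  ax-or : ∀ A B C → Axiom L (((A ≼ B) ∧′ (A ≼ C)) ⇒ (A ≼ (B ∨′ C)))
  ax-n  : Logic.base L ≡ bNN → Axiom L (neg (fls ≼ tru))
  ax-t  : ∀ A → (Logic.base L ≡ bNT ⊎ (Logic.base L ≡ bNW ⊎ Logic.base L ≡ bNC))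
        → Axiom L ((fls ≼ A) ⇒ neg A)
  ax-w  : ∀ A → (Logic.base L ≡ bNW ⊎ Logic.base L ≡ bNC)
        → Axiom L (A ⇒ (A ≼ tru))
  ax-c  : ∀ A → Logic.base L ≡ bNC → Axiom L ((A ≼ tru) ⇒ A)
  ax-u- : ∀ A → Logic.ext L ≡ eU
        → Axiom L (neg (fls ≼ A) ⇒ (fls ≼ (fls ≼ A)))
  ax-u  : ∀ A → Logic.ext L ≡ eU
        → Axiom L ((fls ≼ A) ⇒ (fls ≼ neg (fls ≼ A)))
  ax-a- : ∀ A B → Logic.ext L ≡ eA
        → Axiom L ((A ≼ B) ⇒ (fls ≼ neg (A ≼ B)))
  ax-a  : ∀ A B → Logic.ext L ≡ eA
        → Axiom L (neg (A ≼ B) ⇒ (fls ≼ (A ≼ B)))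

data Derivable (L : Logic) : Fm → Set where
  axiom : ∀ {A} → Axiom L A → Derivable L A
  mp    : ∀ {A B} → Derivable L (A ⇒ B) → Derivable L A → Derivable L B
  cpr   : ∀ {A B} → Derivable L (A ⇒ B) → Derivable L (B ≼ A)

-- Neighbourhood models.  Subsets of W are characteristic functions
-- W → Bool; N(w) is a set of subsets, given as a predicate.

_∈ₛ_ : {W : Set} → W → (W → Bool) → Set
v ∈ₛ α = α v ≡ true

record Model : Set₁ where
  field
    W      : Set
    inhab  : W
    Nb     : W → (W → Bool) → Set
    V      : ℕ → W → Bool
    no-empty : ∀ w α → Nb w α → ¬ (∀ v → α v ≡ false)

open Model public

_,_⊩_ : (M : Model) → W M → Fm → Set
M , w ⊩ var p = w ∈ₛ V M p
M , w ⊩ fls = ⊥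
M , w ⊩ (B ⇒ C) = M , w ⊩ B → M , w ⊩ C
M , w ⊩ (B ≼ C) = ∀ α → Nb M w α →
  Σ (W M) (λ v → v ∈ₛ α × M , v ⊩ C) →
  Σ (W M) (λ u → u ∈ₛ α × M , u ⊩ B)

CondN : Model → Set
CondN M = ∀ w → Σ (W M → Bool) (λ α → Nb M w α)

CondT : Model → Set
CondT M = ∀ w → Σ (W M → Bool) (λ α → Nb M w α × w ∈ₛ α)

CondW : Model → Set
CondW M = ∀ w → Σ (W M → Bool) (λ α → Nb M w α)
               × (∀ α → Nb M w α → w ∈ₛ α)

CondC : Model → Set
CondC M = ∀ w → Σ (W M → Bool) (λ α → Nb M w α × (∀ v → (v ∈ₛ α → v ≡ w) × (v ≡ w → v ∈ₛ α)))
               × (∀ α → Nb M w α → w ∈ₛ α)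

CondU : Model → Set
CondU M = ∀ w α v → Nb M w α → v ∈ₛ α → ∀ u →
  (Σ (W M → Bool) (λ β → Nb M v β × u ∈ₛ β) → Σ (W M → Bool) (λ β → Nb M w β × u ∈ₛ β))
  × (Σ (W M → Bool) (λ β → Nb M w β × u ∈ₛ β) → Σ (W M → Bool) (λ β → Nb M v β × u ∈ₛ β))

CondA : Model → Set
CondA M = ∀ w α v → Nb M w α → v ∈ₛ α → ∀ β →
  (Nb M v β → Nb M w β) × (Nb M w β → Nb M v β)

BaseCond : Base → Model → Set
BaseCond bN  M = Data.Unit.⊤ where import Data.Unit
BaseCond bNN M = CondN M
BaseCond bNT M = CondT M
BaseCond bNW M = CondW M
BaseCond bNC M = CondC M

ExtCond : Ext → Model → Set
ExtCond eNone M = Data.Unit.⊤ where import Data.Unit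
ExtCond eU M = CondU M
ExtCond eA M = CondA M

IsModelOf : Logic → Model → Set
IsModelOf L M = BaseCond (Logic.base L) M × ExtCond (Logic.ext L) M

ValidIn : Logic → Fm → Set₁
ValidIn L A = (M : Model) → IsModelOf L M → (w : W M) → M , w ⊩ A

ExcludedMiddle : Set₁
ExcludedMiddle = (P : Set) → Dec P

-- Completeness via a canonical model, whose worlds are maximal consistent sets. The
-- neighbourhoods of w are the sets α_B = {u | ¬E ∈ u whenever B ≼ E ∈ w}, one for each B
-- with B ≼ ⊤ ∉ w (plus {w} in the logics containing c). The truth lemma for B ≼ C rests on
-- the existence lemma: if B ≼ C ∉ w, then C is consistent with {¬E | B ≼ E ∈ w}. Each axiom
-- validates the matching frame condition on this model, except in NCA: there N(w) = {{w}} is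
-- forced, and indeed B ≼ C collapses to C → B inside every maximal consistent set, so a
-- one-point model suffices.
module Submission where

open import Defs
open import Data.Bool using (Bool; true; false)
open import Data.Empty using (⊥-elim)
open import Data.List using (List; []; _∷_; _++_; foldl; cartesianProductWith)
open import Data.List.Membership.Propositional using (_∈_)
open import Data.List.Membership.Propositional.Properties
  using (∈-++⁺ˡ; ∈-++⁺ʳ; ∈-cartesianProductWith⁺)
open import Data.List.Relation.Unary.Any using (here; there)
open import Data.Nat using (ℕ; zero; suc; _⊔_; _≤′_; ≤′-refl; ≤′-step)
open import Data.Nat.Properties using (m≤m⊔n; m≤n⊔m; ≤⇒≤′)
open import Data.Product using (Σ-syntax; ∃-syntax; _×_; _,_; proj₂)
open import Data.Sum using (_⊎_; inj₁; inj₂; [_,_]; [_,_]′)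
import Data.Sum as Sum
open import Data.Unit using (⊤; tt)
open import Function using (_∘_; id)
open import Function.Bundles using (_⇔_; mk⇔; module Equivalence)
open import Function.Properties.Equivalence using () renaming (sym to ⇔-sym)
open import Level using (0ℓ)
open import Relation.Binary.PropositionalEquality using (_≡_; _≢_; _≗_; refl; sym; trans)
open import Relation.Nullary using (¬_; Dec; yes; no; does)
open import Relation.Nullary.Decidable using (dec-true; does-⇔; decidable-stable)
open import Relation.Unary using (Pred; _⊆_; _∪_; ｛_｝; ∅; ⋃)

open Equivalence using (to; from)

formulasBelow : ℕ → List Fm
formulasBelow zero    = []
formulasBelow (suc n) =
  var n ∷ fls ∷ cartesianProductWith _⇒_ Fs Fs ++ cartesianProductWith _≼_ Fs Fs ++ Fs
  where Fs = formulasBelow n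

formulasBelow-mono : ∀ {A m n} → m ≤′ n → A ∈ formulasBelow m → A ∈ formulasBelow n
formulasBelow-mono ≤′-refl p = p
formulasBelow-mono (≤′-step {n} m≤n) p =
  there (there (∈-++⁺ʳ (cartesianProductWith _⇒_ Fs Fs)
               (∈-++⁺ʳ (cartesianProductWith _≼_ Fs Fs) (formulasBelow-mono m≤n p))))
  where Fs = formulasBelow n

formulasBelow-⊔ : ∀ {A B} a b → A ∈ formulasBelow a → B ∈ formulasBelow b →
                  A ∈ formulasBelow (a ⊔ b) × B ∈ formulasBelow (a ⊔ b)
formulasBelow-⊔ a b A∈ B∈ = formulasBelow-mono (≤⇒≤′ (m≤m⊔n a b)) A∈ ,
                            formulasBelow-mono (≤⇒≤′ (m≤n⊔m a b)) B∈

enumerate : ∀ A → ∃[ n ] A ∈ formulasBelow n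
enumerate (var k) = suc k , here refl
enumerate fls     = 1 , there (here refl)
enumerate (A ⇒ B) with enumerate A | enumerate B
... | a , A∈ | b , B∈ = let A∈′ , B∈′ = formulasBelow-⊔ a b A∈ B∈ in
  suc (a ⊔ b) , there (there (∈-++⁺ˡ (∈-cartesianProductWith⁺ _⇒_ A∈′ B∈′)))
enumerate (A ≼ B) with enumerate A | enumerate B
... | a , A∈ | b , B∈ = let A∈′ , B∈′ = formulasBelow-⊔ a b A∈ B∈ ; Fs = formulasBelow (a ⊔ b) in
  suc (a ⊔ b) , there (there (∈-++⁺ʳ (cartesianProductWith _⇒_ Fs Fs)
                             (∈-++⁺ˡ (∈-cartesianProductWith⁺ _≼_ A∈′ B∈′))))

does-true⇒ : ∀ {P : Set} (p? : Dec P) → does p? ≡ true → P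
does-true⇒ (yes p) _ = p
does-true⇒ (no _) ()

∈ₛ⇒nonempty : ∀ {X : Set} {α : X → Bool} {x} → x ∈ₛ α → ¬ (∀ v → α v ≡ false)
∈ₛ⇒nonempty {x = x} x∈α α≡∅ with trans (sym x∈α) (α≡∅ x)
... | ()

module Completeness (em : ExcludedMiddle) (L : Logic) where

  stable : {P : Set} → ¬ ¬ P → P
  stable {P} = decidable-stable (em P)

  ⇒-refl : ∀ A → Derivable L (A ⇒ A)
  ⇒-refl A = mp (mp (axiom (ax-S A (A ⇒ A) A)) (axiom (ax-K A (A ⇒ A)))) (axiom (ax-K A A))

  Theory : Set₁
  Theory = Pred Fm 0ℓ

  infix 3 _⊢_
  data _⊢_ (Γ : Theory) : Fm → Set where
    hyp : ∀ {A} → Γ A → Γ ⊢ A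
    thm : ∀ {A} → Derivable L A → Γ ⊢ A
    app : ∀ {A B} → Γ ⊢ A ⇒ B → Γ ⊢ A → Γ ⊢ B

  Consistent : Theory → Set
  Consistent Γ = ¬ (Γ ⊢ fls)

  ⊢-trans : ∀ {Γ Δ A} → Γ ⊆ (Δ ⊢_) → Γ ⊢ A → Δ ⊢ A
  ⊢-trans Γ⊢Δ (hyp g)   = Γ⊢Δ g
  ⊢-trans Γ⊢Δ (thm d)   = thm d
  ⊢-trans Γ⊢Δ (app d e) = app (⊢-trans Γ⊢Δ d) (⊢-trans Γ⊢Δ e)

  ⊢-mono : ∀ {Γ Δ A} → Γ ⊆ Δ → Γ ⊢ A → Δ ⊢ A
  ⊢-mono Γ⊆Δ = ⊢-trans (hyp ∘ Γ⊆Δ)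

  ∅⊢⇒derivable : ∀ {A} → ∅ ⊢ A → Derivable L A
  ∅⊢⇒derivable (hyp ())
  ∅⊢⇒derivable (thm d)   = d
  ∅⊢⇒derivable (app d e) = mp (∅⊢⇒derivable d) (∅⊢⇒derivable e)

  deduction : ∀ {Γ A B} → Γ ∪ ｛ A ｝ ⊢ B → Γ ⊢ A ⇒ B
  deduction (hyp (inj₁ g))    = app (thm (axiom (ax-K _ _))) (hyp g)
  deduction (hyp (inj₂ refl)) = thm (⇒-refl _)
  deduction (thm d)           = app (thm (axiom (ax-K _ _))) (thm d)
  deduction (app d e)         = app (app (thm (axiom (ax-S _ _ _))) (deduction d)) (deduction e)

  ⊢-explosion : ∀ {Γ B} → Γ ⊢ fls → Γ ⊢ B
  ⊢-explosion {B = B} d = app (thm (axiom (ax-DN B))) (app (thm (axiom (ax-K fls (neg B)))) d)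

  -- A is added exactly when Γ ∪ {A} is consistent; carrying that proof in the membership
  -- witness avoids deciding consistency in the definition itself.
  extend : Theory → Fm → Theory
  extend Γ A = Γ ∪ (λ X → Consistent (Γ ∪ ｛ A ｝) × A ≡ X)

  extend-consistent : ∀ {Γ A} → Consistent Γ → Consistent (extend Γ A)
  extend-consistent {Γ} {A} Γ-cons with em (Consistent (Γ ∪ ｛ A ｝))
  ... | yes ΓA-cons = ΓA-cons ∘ ⊢-mono (Sum.map₂ proj₂)
  ... | no ¬ΓA-cons = Γ-cons ∘ ⊢-mono [ id , (λ { (ΓA-cons , _) → ⊥-elim (¬ΓA-cons ΓA-cons) }) ]

  extend-decides : ∀ {Γ A} → extend Γ A ⊢ A ⊎ Γ ⊢ neg A
  extend-decides {Γ} {A} with em (Consistent (Γ ∪ ｛ A ｝))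
  ... | yes ΓA-cons = inj₁ (hyp (inj₂ (ΓA-cons , refl)))
  ... | no ¬ΓA-cons = inj₂ (deduction (stable ¬ΓA-cons))

  foldl-extend-⊇ : ∀ {Γ} As → Γ ⊆ foldl extend Γ As
  foldl-extend-⊇ []       g = g
  foldl-extend-⊇ (A ∷ As) g = foldl-extend-⊇ As (inj₁ g)

  foldl-extend-consistent : ∀ {Γ} As → Consistent Γ → Consistent (foldl extend Γ As)
  foldl-extend-consistent []       c = c
  foldl-extend-consistent (A ∷ As) c = foldl-extend-consistent As (extend-consistent c)

  foldl-extend-decides : ∀ {Γ A As} → A ∈ As →
                         foldl extend Γ As ⊢ A ⊎ foldl extend Γ As ⊢ neg A
  foldl-extend-decides {As = A ∷ As} (here refl) =
    Sum.map (⊢-mono (foldl-extend-⊇ As)) (⊢-mono (foldl-extend-⊇ As ∘ inj₁)) extend-decides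
  foldl-extend-decides {As = _ ∷ As} (there A∈) = foldl-extend-decides {As = As} A∈

  stage : Theory → ℕ → Theory
  stage Γ zero    = Γ
  stage Γ (suc n) = foldl extend (stage Γ n) (formulasBelow n)

  stage-mono : ∀ {Γ m n} → m ≤′ n → stage Γ m ⊆ stage Γ n
  stage-mono ≤′-refl             g = g
  stage-mono (≤′-step {n} m≤n) g = foldl-extend-⊇ (formulasBelow n) (stage-mono m≤n g)

  stage-consistent : ∀ {Γ} → Consistent Γ → ∀ n → Consistent (stage Γ n)
  stage-consistent c zero    = c
  stage-consistent c (suc n) = foldl-extend-consistent (formulasBelow n) (stage-consistent c n)

  limit : Theory → Theory
  limit Γ = ⋃ ℕ (stage Γ)

  limit-compact : ∀ {Γ A} → limit Γ ⊢ A → ∃[ n ] stage Γ n ⊢ A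
  limit-compact (hyp (n , g)) = n , hyp g
  limit-compact (thm d)       = 0 , thm d
  limit-compact (app d e) with limit-compact d | limit-compact e
  ... | m , d′ | n , e′ = m ⊔ n , app (⊢-mono (stage-mono (≤⇒≤′ (m≤m⊔n m n))) d′)
                                      (⊢-mono (stage-mono (≤⇒≤′ (m≤n⊔m m n))) e′)

  limit-consistent : ∀ {Γ} → Consistent Γ → Consistent (limit Γ)
  limit-consistent c d = let n , d′ = limit-compact d in stage-consistent c n d′

  limit-decides : ∀ {Γ} A → limit Γ ⊢ A ⊎ limit Γ ⊢ neg A
  limit-decides {Γ} A with enumerate A
  ... | n , A∈ = Sum.map (⊢-mono (suc n ,_)) (⊢-mono (suc n ,_))
                         (foldl-extend-decides {stage Γ n} A∈)

  -- Membership is Bool-valued so that maximal consistent sets form a Set, as worlds must;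
  -- _∋_ wraps it in a record so that w is inferable from w ∋ A.
  record MCS : Set where
    field
      mem        : Fm → Bool
      closed     : ∀ {A} → (λ X → mem X ≡ true) ⊢ A → mem A ≡ true
      consistent : mem fls ≢ true
      complete   : ∀ A → mem A ≡ true ⊎ mem (neg A) ≡ true

  infix 4 _∋_
  record _∋_ (w : MCS) (A : Fm) : Set where
    constructor mem⁺
    field mem⁻ : MCS.mem w A ≡ true
  open _∋_

  lindenbaum : ∀ {Γ} → Consistent Γ → Σ[ w ∈ MCS ] Γ ⊆ (w ∋_)
  lindenbaum {Γ} Γ-cons = w , λ g → mem⁺ (dec-true (em _) (hyp (0 , g)))
    where
    w : MCS
    w = record
      { mem        = λ A → does (em (limit Γ ⊢ A))
      ; closed     = λ d → dec-true (em _) (⊢-trans (does-true⇒ (em _)) d)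
      ; consistent = limit-consistent Γ-cons ∘ does-true⇒ (em _)
      ; complete   = λ A → Sum.map (dec-true (em _)) (dec-true (em _)) (limit-decides A)
      }

  module _ {w : MCS} where

    ∋-closed : ∀ {A} → (w ∋_) ⊢ A → w ∋ A
    ∋-closed d = mem⁺ (MCS.closed w (⊢-mono mem⁻ d))

    ∌-fls : ¬ w ∋ fls
    ∌-fls = MCS.consistent w ∘ mem⁻

    ∋-complete : ∀ A → w ∋ A ⊎ w ∋ neg A
    ∋-complete A = Sum.map mem⁺ mem⁺ (MCS.complete w A)

    ∋-derivable : ∀ {A} → Derivable L A → w ∋ A
    ∋-derivable = ∋-closed ∘ thm

    ∋-axiom : ∀ {A} → Axiom L A → w ∋ A
    ∋-axiom = ∋-derivable ∘ axiom

    ∋-mp : ∀ {A B} → w ∋ A ⇒ B → w ∋ A → w ∋ B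
    ∋-mp A⇒B A = ∋-closed (app (hyp A⇒B) (hyp A))

    ∋-neg⁻ : ∀ {A} → w ∋ neg A → ¬ w ∋ A
    ∋-neg⁻ ¬A = ∌-fls ∘ ∋-mp ¬A

    ∋-neg⁺ : ∀ {A} → ¬ w ∋ A → w ∋ neg A
    ∋-neg⁺ {A} ∌A = [ ⊥-elim ∘ ∌A , id ]′ (∋-complete A)

    ∋-stable : ∀ {A} → ¬ ¬ w ∋ A → w ∋ A
    ∋-stable {A} ¬∌A = [ id , ⊥-elim ∘ ¬∌A ∘ ∋-neg⁻ ]′ (∋-complete A)

    ∋-¬¬⁻ : ∀ {A} → w ∋ neg (neg A) → w ∋ A
    ∋-¬¬⁻ ¬¬A = ∋-stable (∋-neg⁻ ¬¬A ∘ ∋-neg⁺)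

    ∋-⇒⁺ : ∀ {A B} → (w ∋ A → w ∋ B) → w ∋ A ⇒ B
    ∋-⇒⁺ {A} f with ∋-complete A
    ... | inj₁ A  = ∋-closed (deduction (hyp (inj₁ (f A))))
    ... | inj₂ ¬A = ∋-closed (deduction (⊢-explosion (app (hyp (inj₁ ¬A)) (hyp (inj₂ refl)))))

    ∋-⊤ : w ∋ tru
    ∋-⊤ = ∋-⇒⁺ id

    ∋-∧⁺ : ∀ {A B} → w ∋ A → w ∋ B → w ∋ A ∧′ B
    ∋-∧⁺ A B = ∋-neg⁺ λ A⇒¬B → ∋-neg⁻ (∋-mp A⇒¬B A) B

    ∋-∧⁻ˡ : ∀ {A B} → w ∋ A ∧′ B → w ∋ A
    ∋-∧⁻ˡ A∧B = ∋-stable λ ∌A → ∋-neg⁻ A∧B (∋-⇒⁺ (⊥-elim ∘ ∌A))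

    ∋-∧⁻ʳ : ∀ {A B} → w ∋ A ∧′ B → w ∋ B
    ∋-∧⁻ʳ A∧B = ∋-stable λ ∌B → ∋-neg⁻ A∧B (∋-⇒⁺ λ _ → ∋-neg⁺ ∌B)

    ∋-∨⁺ˡ : ∀ {A B} → w ∋ A → w ∋ A ∨′ B
    ∋-∨⁺ˡ A = ∋-⇒⁺ λ ¬A → ⊥-elim (∋-neg⁻ ¬A A)

    ∋-∨⁺ʳ : ∀ {A B} → w ∋ B → w ∋ A ∨′ B
    ∋-∨⁺ʳ B = ∋-⇒⁺ λ _ → B

  refuting-mcs : ∀ {A} → ¬ Derivable L A → Σ[ w ∈ MCS ] ¬ w ∋ A
  refuting-mcs {A} ⊬A with lindenbaum {∅ ∪ ｛ neg A ｝} ¬A-consistent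
    where
    ¬A-consistent : Consistent (∅ ∪ ｛ neg A ｝)
    ¬A-consistent = ⊬A ∘ ∅⊢⇒derivable ∘ app (thm (axiom (ax-DN A))) ∘ deduction
  ... | w , ⊆w = w , ∋-neg⁻ (⊆w (inj₂ refl))

  derivable-if-in-every-mcs : ∀ {A} → (∀ w → w ∋ A) → Derivable L A
  derivable-if-in-every-mcs ∀w∋A = stable λ ⊬A → let w , w∌A = refuting-mcs ⊬A in w∌A (∀w∋A w)

  entailment⇒derivable : ∀ {A B} → (∀ w → w ∋ A → w ∋ B) → Derivable L (A ⇒ B)
  entailment⇒derivable A⊨B = derivable-if-in-every-mcs (∋-⇒⁺ ∘ A⊨B)

  module _ {w : MCS} where

    ∋-cpr : ∀ {A B} → Derivable L (A ⇒ B) → w ∋ B ≼ A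
    ∋-cpr = ∋-derivable ∘ cpr

    ∋-tr : ∀ {A B C} → w ∋ A ≼ B → w ∋ B ≼ C → w ∋ A ≼ C
    ∋-tr A≼B B≼C = ∋-mp (∋-axiom (ax-tr _ _ _)) (∋-∧⁺ A≼B B≼C)

    ∋-or : ∀ {A B C} → w ∋ A ≼ B → w ∋ A ≼ C → w ∋ A ≼ B ∨′ C
    ∋-or A≼B A≼C = ∋-mp (∋-axiom (ax-or _ _ _)) (∋-∧⁺ A≼B A≼C)

    ∋-≼-refl : ∀ {A} → w ∋ A ≼ A
    ∋-≼-refl = ∋-cpr (⇒-refl _)

    ∋-≼-antitone : ∀ {A B C} → (∀ v → v ∋ B → v ∋ C) → w ∋ A ≼ C → w ∋ A ≼ B
    ∋-≼-antitone B⊨C A≼C = ∋-tr A≼C (∋-cpr (entailment⇒derivable B⊨C))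

    ∋-≼-unsatisfiable : ∀ {A B} → (∀ v → ¬ v ∋ B) → w ∋ A ≼ B
    ∋-≼-unsatisfiable ∄B = ∋-cpr (entailment⇒derivable λ v → ⊥-elim ∘ ∄B v)

    ∋-≼⊥ : ∀ {A} → w ∋ A ≼ fls
    ∋-≼⊥ = ∋-≼-unsatisfiable λ _ → ∌-fls

    ∋-≼⊤⇒≼ : ∀ {A B} → w ∋ A ≼ tru → w ∋ A ≼ B
    ∋-≼⊤⇒≼ = ∋-≼-antitone λ _ _ → ∋-⊤

  NegationsBelow : MCS → Fm → Theory
  NegationsBelow w B X = ∃[ E ] w ∋ B ≼ E × neg E ≡ X

  -- For a hypothesis ¬E, C ∧ ¬¬E implies E, so B ≼ E suffices; modus ponens is handled by (or),
  -- since C ∧ ¬F₂ implies C ∧ ¬(F₁ ⇒ F₂) or C ∧ ¬F₁.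
  ⊢⇒≼-∧-neg : ∀ {w B C F} → NegationsBelow w B ∪ ｛ C ｝ ⊢ F → w ∋ B ≼ C ∧′ neg F
  ⊢⇒≼-∧-neg (hyp (inj₁ (E , B≼E , refl))) = ∋-≼-antitone (λ _ → ∋-¬¬⁻ ∘ ∋-∧⁻ʳ) B≼E
  ⊢⇒≼-∧-neg (hyp (inj₂ refl)) = ∋-≼-unsatisfiable λ _ C∧¬C → ∋-neg⁻ (∋-∧⁻ʳ C∧¬C) (∋-∧⁻ˡ C∧¬C)
  ⊢⇒≼-∧-neg (thm d) = ∋-≼-unsatisfiable λ _ C∧¬F → ∋-neg⁻ (∋-∧⁻ʳ C∧¬F) (∋-derivable d)
  ⊢⇒≼-∧-neg {C = C} (app {F₁} {F₂} d e) =
    ∋-≼-antitone split (∋-or (⊢⇒≼-∧-neg d) (⊢⇒≼-∧-neg e))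
    where
    split : ∀ v → v ∋ C ∧′ neg F₂ → v ∋ (C ∧′ neg (F₁ ⇒ F₂)) ∨′ (C ∧′ neg F₁)
    split v C∧¬F₂ with ∋-complete F₁
    ... | inj₁ F₁  = ∋-∨⁺ˡ (∋-∧⁺ (∋-∧⁻ˡ C∧¬F₂) (∋-neg⁺ λ F₁⇒F₂ → ∋-neg⁻ (∋-∧⁻ʳ C∧¬F₂) (∋-mp F₁⇒F₂ F₁)))
    ... | inj₂ ¬F₁ = ∋-∨⁺ʳ (∋-∧⁺ (∋-∧⁻ˡ C∧¬F₂) ¬F₁)

  negationsBelow-consistent : ∀ {w B C} → ¬ w ∋ B ≼ C → Consistent (NegationsBelow w B ∪ ｛ C ｝)
  negationsBelow-consistent ∌B≼C =
    ∌B≼C ∘ ∋-≼-antitone (λ _ C → ∋-∧⁺ C (∋-neg⁺ ∌-fls)) ∘ ⊢⇒≼-∧-neg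

  Nbhd : MCS → Fm → Pred MCS 0ℓ
  Nbhd w B u = ∀ E → w ∋ B ≼ E → u ∋ neg E

  existence : ∀ {w B C} → ¬ w ∋ B ≼ C → ∃[ v ] v ∋ C × Nbhd w B v
  existence ∌B≼C with lindenbaum (negationsBelow-consistent ∌B≼C)
  ... | v , ⊆v = v , ⊆v (inj₂ refl) , λ E B≼E → ⊆v (inj₁ (E , B≼E , refl))

  nbhd-witness : ∀ {w B B′ C v} → w ∋ B ≼ C → Nbhd w B′ v → v ∋ C → ∃[ u ] u ∋ B × Nbhd w B′ u
  nbhd-witness B≼C v∈ C = existence λ B′≼B → ∋-neg⁻ (v∈ _ (∋-tr B′≼B B≼C)) C

  characteristic : {X : Set} → Pred X 0ℓ → X → Bool
  characteristic P x = does (em (P x))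

  module _ {X : Set} {P : Pred X 0ℓ} {α : X → Bool} (α≗P : α ≗ characteristic P) where

    ∈-characteristic⁺ : ∀ {x} → P x → x ∈ₛ α
    ∈-characteristic⁺ {x} Px = trans (α≗P x) (dec-true (em (P x)) Px)

    ∈-characteristic⁻ : ∀ {x} → x ∈ₛ α → P x
    ∈-characteristic⁻ {x} x∈α = does-true⇒ (em (P x)) (trans (sym (α≗P x)) x∈α)

  -- B ≼ ⊤ ∉ w is exactly what makes α_B nonempty, by the existence lemma.
  CanonicalNb : MCS → (MCS → Bool) → Set
  CanonicalNb w α = (∃[ B ] ¬ w ∋ B ≼ tru × α ≗ characteristic (Nbhd w B))
                  ⊎ (Logic.base L ≡ bNC × α ≗ characteristic (_≡ w))

  canonicalNb-nonempty : ∀ w α → CanonicalNb w α → ¬ (∀ v → α v ≡ false)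
  canonicalNb-nonempty w α (inj₁ (B , ∌B≼⊤ , α≗)) =
    let v , _ , v∈ = existence ∌B≼⊤ in ∈ₛ⇒nonempty (∈-characteristic⁺ α≗ v∈)
  canonicalNb-nonempty w α (inj₂ (_ , α≗)) = ∈ₛ⇒nonempty (∈-characteristic⁺ α≗ refl)

  canonical : MCS → Model
  canonical w₀ = record
    { W        = MCS
    ; inhab    = w₀
    ; Nb       = CanonicalNb
    ; V        = λ p w → MCS.mem w (var p)
    ; no-empty = canonicalNb-nonempty
    }

  HasT : Set
  HasT = Logic.base L ≡ bNT ⊎ (Logic.base L ≡ bNW ⊎ Logic.base L ≡ bNC)

  HasW : Set
  HasW = Logic.base L ≡ bNW ⊎ Logic.base L ≡ bNC

  module _ {w : MCS} where

    ∋-t : HasT → ∀ {E} → w ∋ fls ≼ E → w ∋ neg E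
    ∋-t t = ∋-mp (∋-axiom (ax-t _ t))

    ∌⊥≼⊤ : HasT → ¬ w ∋ fls ≼ tru
    ∌⊥≼⊤ t ⊥≼⊤ = ∋-neg⁻ (∋-t t ⊥≼⊤) ∋-⊤

    ∋-w : HasW → ∀ {A} → w ∋ A → w ∋ A ≼ tru
    ∋-w h = ∋-mp (∋-axiom (ax-w _ h))

    ∋-c : Logic.base L ≡ bNC → ∀ {A} → w ∋ A ≼ tru → w ∋ A
    ∋-c c = ∋-mp (∋-axiom (ax-c _ c))

    ∋-≼-elim : Logic.base L ≡ bNC → ∀ {B C} → w ∋ B ≼ C → w ∋ C → w ∋ B
    ∋-≼-elim c B≼C C = ∋-c c (∋-tr B≼C (∋-w (inj₂ c) C))

  module _ (w₀ : MCS) where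

    truth : ∀ A w → canonical w₀ , w ⊩ A ⇔ w ∋ A
    truth (var p) w = mk⇔ mem⁺ mem⁻
    truth fls     w = mk⇔ ⊥-elim ∌-fls
    truth (B ⇒ C) w = mk⇔ (λ ⊩B⇒C → ∋-⇒⁺ (to (truth C w) ∘ ⊩B⇒C ∘ from (truth B w)))
                          (λ B⇒C → from (truth C w) ∘ ∋-mp B⇒C ∘ to (truth B w))
    truth (B ≼ C) w = mk⇔ complete sound
      where
      sound : w ∋ B ≼ C → canonical w₀ , w ⊩ (B ≼ C)
      sound B≼C α (inj₁ (_ , _ , α≗)) (v , v∈α , v⊩C) =
        let u , u∋B , u∈ = nbhd-witness B≼C (∈-characteristic⁻ α≗ v∈α) (to (truth C v) v⊩C)
        in u , ∈-characteristic⁺ α≗ u∈ , from (truth B u) u∋B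
      sound B≼C α (inj₂ (c , α≗)) (v , v∈α , v⊩C) with ∈-characteristic⁻ α≗ v∈α
      ... | refl = v , v∈α , from (truth B v) (∋-≼-elim c B≼C (to (truth C v) v⊩C))

      complete : canonical w₀ , w ⊩ (B ≼ C) → w ∋ B ≼ C
      complete ⊩B≼C = ∋-stable λ ∌B≼C →
        let v , v∋C , v∈ = existence ∌B≼C
            αB : CanonicalNb w (characteristic (Nbhd w B))
            αB = inj₁ (B , ∌B≼C ∘ ∋-≼⊤⇒≼ , λ _ → refl)
            u , u∈ , u⊩B = ⊩B≼C _ αB (v , ∈-characteristic⁺ {P = Nbhd w B} (λ _ → refl) v∈ , from (truth C v) v∋C)
        in ∋-neg⁻ (∈-characteristic⁻ {P = Nbhd w B} (λ _ → refl) u∈ B ∋-≼-refl) (to (truth B u) u⊩B)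

  ⊥-nbhd : ∀ {w} → ¬ w ∋ fls ≼ tru → CanonicalNb w (characteristic (Nbhd w fls))
  ⊥-nbhd ∌⊥≼⊤ = inj₁ (fls , ∌⊥≼⊤ , λ _ → refl)

  canonicalNb-reflexive : HasW → ∀ {w α} → CanonicalNb w α → w ∈ₛ α
  canonicalNb-reflexive h (inj₁ (B , ∌B≼⊤ , α≗)) =
    ∈-characteristic⁺ α≗ λ E B≼E → ∋-neg⁺ (∌B≼⊤ ∘ ∋-tr B≼E ∘ ∋-w h)
  canonicalNb-reflexive h (inj₂ (_ , α≗)) = ∈-characteristic⁺ α≗ refl

  canonicalNb⊆Nbhd⊥ : ∀ {w α v} → CanonicalNb w α → v ∈ₛ α → Nbhd w fls v
  canonicalNb⊆Nbhd⊥ (inj₁ (_ , _ , α≗)) v∈α E ⊥≼E = ∈-characteristic⁻ α≗ v∈α E (∋-tr ∋-≼⊥ ⊥≼E)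
  canonicalNb⊆Nbhd⊥ (inj₂ (c , α≗)) v∈α with ∈-characteristic⁻ α≗ v∈α
  ... | refl = λ _ → ∋-t (inj₂ (inj₂ c))

  canonicalNb⇒∌⊥≼⊤ : ∀ {w α} → CanonicalNb w α → ¬ w ∋ fls ≼ tru
  canonicalNb⇒∌⊥≼⊤ (inj₁ (_ , ∌B≼⊤ , _)) = ∌B≼⊤ ∘ ∋-tr ∋-≼⊥
  canonicalNb⇒∌⊥≼⊤ (inj₂ (c , _))        = ∌⊥≼⊤ (inj₂ (inj₂ c))

  Nbhd⊥⇒∈⋃canonicalNb : ∀ {w u} → ¬ w ∋ fls ≼ tru → Nbhd w fls u →
                         ∃[ β ] CanonicalNb w β × u ∈ₛ β
  Nbhd⊥⇒∈⋃canonicalNb {w} ∌⊥≼⊤ u∈ = _ , ⊥-nbhd ∌⊥≼⊤ , ∈-characteristic⁺ {P = Nbhd w fls} (λ _ → refl) u∈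

  -- Worlds of the ⊥-neighbourhood of w agree with w on every P that the axioms make "certain"
  -- whether true or false; (u−, u) and (a−, a) provide this for ⊥ ≼ E and for X ≼ Y.
  ∋-transfer : ∀ {w v P} → Nbhd w fls v →
               w ∋ P ⇒ (fls ≼ neg P) → w ∋ neg P ⇒ (fls ≼ P) → w ∋ P ⇔ v ∋ P
  ∋-transfer v∈ P-certain ¬P-certain = mk⇔
    (λ P → ∋-¬¬⁻ (v∈ _ (∋-mp P-certain P)))
    (λ v∋P → ∋-stable λ ∌P → ∋-neg⁻ (v∈ _ (∋-mp ¬P-certain (∋-neg⁺ ∌P))) v∋P)

  canonicalNb-transfer : Logic.base L ≢ bNC → ∀ {w v β} →
                         (∀ X Y → w ∋ X ≼ Y ⇔ v ∋ X ≼ Y) → CanonicalNb w β → CanonicalNb v β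
  canonicalNb-transfer _ agree (inj₁ (B , ∌B≼⊤ , β≗)) =
    inj₁ (B , ∌B≼⊤ ∘ from (agree B tru) ,
          λ u → trans (β≗ u) (does-⇔ (mk⇔ (λ u∈ E → u∈ E ∘ from (agree B E))
                                          (λ u∈ E → u∈ E ∘ to (agree B E))) (em _) (em _)))
  canonicalNb-transfer ¬c _ (inj₂ (c , _)) = ⊥-elim (¬c c)

  module _ (w₀ : MCS) where

    canonical-N : Logic.base L ≡ bNN → CondN (canonical w₀)
    canonical-N n w = _ , ⊥-nbhd (∋-neg⁻ (∋-axiom (ax-n n)))

    canonical-T : HasT → CondT (canonical w₀)
    canonical-T t w = _ , ⊥-nbhd (∌⊥≼⊤ t) , ∈-characteristic⁺ {P = Nbhd w fls} (λ _ → refl) (λ _ → ∋-t t)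

    canonical-W : HasW → CondW (canonical w₀)
    canonical-W h w = (_ , ⊥-nbhd (∌⊥≼⊤ (inj₂ h))) , λ _ → canonicalNb-reflexive h

    canonical-C : Logic.base L ≡ bNC → CondC (canonical w₀)
    canonical-C c w =
      (_ , inj₂ (c , λ _ → refl) ,
       λ v → ∈-characteristic⁻ {P = _≡ w} (λ _ → refl) , ∈-characteristic⁺ {P = _≡ w} (λ _ → refl)) ,
      λ _ → canonicalNb-reflexive (inj₂ c)

    canonical-U : Logic.ext L ≡ eU → CondU (canonical w₀)
    canonical-U eu w α v α∈ v∈α u = ⋃N[v]⊆⋃N[w] , ⋃N[w]⊆⋃N[v]
      where
      agree : ∀ E → w ∋ fls ≼ E ⇔ v ∋ fls ≼ E
      agree E = ∋-transfer (canonicalNb⊆Nbhd⊥ α∈ v∈α) (∋-axiom (ax-u E eu)) (∋-axiom (ax-u- E eu))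
      ⋃N[v]⊆⋃N[w] : ∃[ β ] CanonicalNb v β × u ∈ₛ β → ∃[ β ] CanonicalNb w β × u ∈ₛ β
      ⋃N[v]⊆⋃N[w] (_ , β∈ , u∈β) = Nbhd⊥⇒∈⋃canonicalNb (canonicalNb⇒∌⊥≼⊤ α∈)
        λ E → canonicalNb⊆Nbhd⊥ β∈ u∈β E ∘ to (agree E)
      ⋃N[w]⊆⋃N[v] : ∃[ β ] CanonicalNb w β × u ∈ₛ β → ∃[ β ] CanonicalNb v β × u ∈ₛ β
      ⋃N[w]⊆⋃N[v] (_ , β∈ , u∈β) = Nbhd⊥⇒∈⋃canonicalNb (canonicalNb⇒∌⊥≼⊤ α∈ ∘ from (agree tru))
        λ E → canonicalNb⊆Nbhd⊥ β∈ u∈β E ∘ from (agree E)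

    canonical-A : Logic.ext L ≡ eA → Logic.base L ≢ bNC → CondA (canonical w₀)
    canonical-A ea ¬c w α v α∈ v∈α β =
      canonicalNb-transfer ¬c (λ X Y → ⇔-sym (agree X Y)) , canonicalNb-transfer ¬c agree
      where
      agree : ∀ X Y → w ∋ X ≼ Y ⇔ v ∋ X ≼ Y
      agree X Y = ∋-transfer (canonicalNb⊆Nbhd⊥ α∈ v∈α) (∋-axiom (ax-a- X Y ea)) (∋-axiom (ax-a X Y ea))

    canonical-base : ∀ b → Logic.base L ≡ b → BaseCond b (canonical w₀)
    canonical-base bN  _ = tt
    canonical-base bNN n = canonical-N n
    canonical-base bNT t = canonical-T (inj₁ t)
    canonical-base bNW w = canonical-W (inj₁ w)
    canonical-base bNC c = canonical-C c

    canonical-ext : ∀ e → Logic.ext L ≡ e → (e ≡ eA → Logic.base L ≢ bNC) → ExtCond e (canonical w₀)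
    canonical-ext eNone _  _     = tt
    canonical-ext eU    eu _     = canonical-U eu
    canonical-ext eA    ea ¬NCA = canonical-A ea (¬NCA refl)

  Satisfiable : MCS → Set₁
  Satisfiable w = Σ[ M ∈ Model ] IsModelOf L M × Σ[ x ∈ W M ] (∀ A → M , x ⊩ A ⇔ w ∋ A)

  completeness : (∀ w → Satisfiable w) → ∀ A → ValidIn L A → Derivable L A
  completeness satisfiable A valid = derivable-if-in-every-mcs λ w →
    let M , M-model , x , x≡w = satisfiable w in to (x≡w A) (valid M M-model x)

  canonical-satisfiable : (Logic.ext L ≡ eA → Logic.base L ≢ bNC) → ∀ w → Satisfiable w
  canonical-satisfiable ¬NCA w =
    canonical w , (canonical-base w _ refl , canonical-ext w _ refl ¬NCA) , w , λ A → truth w A w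

  ∋-≼⇔converse : Logic.base L ≡ bNC → Logic.ext L ≡ eA →
                 ∀ {w B C} → w ∋ B ≼ C ⇔ (w ∋ C → w ∋ B)
  ∋-≼⇔converse c ea {w} {B} {C} = mk⇔ (∋-≼-elim c) intro
    where
    intro : (w ∋ C → w ∋ B) → w ∋ B ≼ C
    intro C⇒B with ∋-complete C
    ... | inj₁ w∋C = ∋-≼⊤⇒≼ (∋-w (inj₂ c) (C⇒B w∋C))
    ... | inj₂ ¬C  = ∋-tr ∋-≼⊥ (∋-tr ⊥≼[C≼⊤] (∋-cpr (axiom (ax-w C (inj₂ c)))))
      where
      ⊥≼[C≼⊤] : w ∋ fls ≼ (C ≼ tru)
      ⊥≼[C≼⊤] = ∋-mp (∋-axiom (ax-a C tru ea)) (∋-neg⁺ (∋-neg⁻ ¬C ∘ ∋-c c))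

  point : MCS → Model
  point w = record
    { W        = ⊤
    ; inhab    = tt
    ; Nb       = λ _ α → α tt ≡ true
    ; V        = λ p _ → MCS.mem w (var p)
    ; no-empty = λ _ _ → ∈ₛ⇒nonempty
    }

  point-C : ∀ w → CondC (point w)
  point-C _ _ = (_ , refl , λ _ → (λ _ → refl) , (λ _ → refl)) , λ _ → id

  point-A : ∀ w → CondA (point w)
  point-A _ _ _ _ _ _ _ = id , id

  point-truth : ∀ {w} → (∀ {B C} → w ∋ B ≼ C ⇔ (w ∋ C → w ∋ B)) →
                ∀ A → point w , tt ⊩ A ⇔ w ∋ A
  point-truth collapse (var p) = mk⇔ mem⁺ mem⁻
  point-truth collapse fls     = mk⇔ ⊥-elim ∌-fls
  point-truth collapse (B ⇒ C) =
    mk⇔ (λ ⊩B⇒C → ∋-⇒⁺ (to (point-truth collapse C) ∘ ⊩B⇒C ∘ from (point-truth collapse B)))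
        (λ B⇒C → from (point-truth collapse C) ∘ ∋-mp B⇒C ∘ to (point-truth collapse B))
  point-truth collapse (B ≼ C) = mk⇔
    (λ ⊩B≼C → from collapse λ w∋C →
      to (point-truth collapse B) (proj₂ (proj₂ (⊩B≼C _ refl (tt , refl , from (point-truth collapse C) w∋C)))))
    (λ B≼C _ tt∈α (_ , _ , ⊩C) →
      tt , tt∈α , from (point-truth collapse B) (to collapse B≼C (to (point-truth collapse C) ⊩C)))

mcs-satisfiable : (em : ExcludedMiddle) (L : Logic) → ∀ w → Completeness.Satisfiable em L w
mcs-satisfiable em (logic bNC eA) w =
  point w , (point-C w , point-A w) , tt , point-truth (∋-≼⇔converse refl refl)
  where open Completeness em (logic bNC eA)
mcs-satisfiable em L@(logic bNC eNone) = Completeness.canonical-satisfiable em L λ ()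
mcs-satisfiable em L@(logic bNC eU)    = Completeness.canonical-satisfiable em L λ ()
mcs-satisfiable em L@(logic bN  _)     = Completeness.canonical-satisfiable em L λ _ ()
mcs-satisfiable em L@(logic bNN _)     = Completeness.canonical-satisfiable em L λ _ ()
mcs-satisfiable em L@(logic bNT _)     = Completeness.canonical-satisfiable em L λ _ ()
mcs-satisfiable em L@(logic bNW _)     = Completeness.canonical-satisfiable em L λ _ ()

theorem3p9 : ExcludedMiddle → (L : Logic) (A : Fm) → ValidIn L A → Derivable L A
theorem3p9 em L = Completeness.completeness em L (mcs-satisfiable em L)
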